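{- Let $w=w_1\cdots w_n$ be a Christoffel word of length $n$ over $\{a,b\}$, and let $w=uv$ be its palindromic factorization, with cut position $c=|u|$. Fix $k$ with $0\le k\le n$. Let $f_1,f_2,\ldots,f_r$ be the words $w_{s+1}\cdots w_{s+k}$ for the integers $s$ with $0\le s\le n-k$ and $s\le c\le s+k$, listed in increasing order of $s$ (factors of length $k$ meeting the cut, ordered from left to right). Let $g_1,g_2,\ldots,g_{r'}$ be the words $w_{t+1}\cdots w_{t+n-k}$ for the integers $t$ with $0\le t\le k$ and $t\le c\le t+n-k$, listed in decreasing order of $t$ (factors of length $n-k$ meeting the cut, ordered from right to left). Then $r=r'$, the words $f_1,\ldots,f_r$ are pairwise distinct, the words $g_1,\ldots,g_r$ are pairwise distinct, and the map $f_i\mapsto g_i$ is a bijection from the set of all factors of length $k$ of $w$ onto the set of all factors of length $n-k$ of $w$ satisfying $\gamma(f_i)+\gamma(g_i)=\gamma(w)$ for every $i$.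
   Context: Words are finite words over $\{a,b\}$; a factor of $w$ is a contiguous subword (including the empty word). The Parikh image of a word $x$ is $\gamma(x)=(|x|_a,|x|_b)$. A palindrome is a word equal to its reversal (the empty word is a palindrome). A Christoffel word is either $a$, or $b$, or a word $w=amb$ or $w=bma$ with $m$ a palindrome and $w$ a product of two palindromes. The palindromic factorization of a Christoffel word $w$ is a factorization $w=uv$ with $u$ and $v$ palindromes; for $|w|\ge2$ it is unique (for $|w|=1$ either of the two such factorizations may be taken). -}

module Defs where

open import Data.Nat using (ℕ; zero; suc; _+_; _∸_; _≤ᵇ_)
open import Data.Bool using (_∧_)
open import Data.List using (List; []; _∷_; _++_; [_]; reverse; length; take; drop; upTo; map; filterᵇ)
open import Data.Product using (_×_; _,_; ∃-syntax)
open import Data.Sum using (_⊎_)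
open import Relation.Binary.PropositionalEquality using (_≡_)

data Letter : Set where
  a b : Letter

Word : Set
Word = List Letter

Palindrome : Word → Set
Palindrome w = reverse w ≡ w

IsChristoffel : Word → Set
IsChristoffel w =
  (w ≡ [ a ]) ⊎ (w ≡ [ b ]) ⊎
  (∃[ m ] Palindrome m
        × ((w ≡ a ∷ (m ++ [ b ])) ⊎ (w ≡ b ∷ (m ++ [ a ])))
        × (∃[ p ] ∃[ q ] Palindrome p × Palindrome q × w ≡ p ++ q))

PalFact : Word → Word → Word → Set
PalFact w u v = Palindrome u × Palindrome v × w ≡ u ++ v

Factor : Word → Word → Set
Factor x w = ∃[ y ] ∃[ z ] w ≡ y ++ (x ++ z)

countA : Word → ℕ
countA [] = 0
countA (a ∷ w) = suc (countA w)
countA (b ∷ w) = countA w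

countB : Word → ℕ
countB [] = 0
countB (a ∷ w) = countB w
countB (b ∷ w) = suc (countB w)

parikh : Word → ℕ × ℕ
parikh w = countA w , countB w

_⊕_ : ℕ × ℕ → ℕ × ℕ → ℕ × ℕ
(x₁ , y₁) ⊕ (x₂ , y₂) = (x₁ + x₂) , (y₁ + y₂)

factorAt : Word → ℕ → ℕ → Word
factorAt w s k = take k (drop s w)

cutFactorsK : Word → ℕ → ℕ → List Word
cutFactorsK w c k =
  map (λ s → factorAt w s k)
      (filterᵇ (λ s → (s ≤ᵇ c) ∧ (c ≤ᵇ s + k)) (upTo (suc (length w ∸ k))))

cutFactorsCoK : Word → ℕ → ℕ → List Word
cutFactorsCoK w c k =
  map (λ t → factorAt w t (length w ∸ k))
      (reverse (filterᵇ (λ t → (t ≤ᵇ c) ∧ (c ≤ᵇ t + (length w ∸ k))) (upTo (suc k))))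

-- Let p = |u|, q = |v| and n = p + q. Since u, v and w stripped of its two (distinct) end letters
-- are palindromes, the letter at x equals the letter at x + q (mod n) except at the positions
-- p - 1 and p flanking the cut. Following the orbit of 0 under this rotation, the letter w[0]
-- persists until the orbit enters p - 1 (entering p would give w[0] = w[p] = w[n-1]), so q is
-- invertible mod n and the rotation is transitive. Rotating a window that does not meet the cut
-- keeps its letters, hence every factor occurs at a position meeting the cut. Two equal windows
-- meeting the cut would produce a square centred on the cut, again forcing w[0] = w[n-1]. Finally,
-- the window at s and the complementary window at p - s are assembled from pieces of u and v and
-- the reversals of the complementary pieces, so their Parikh vectors add up to that of w.
module Submission where

open import Defs
open import Data.Nat
open import Data.Nat.Properties
open import Data.Nat.DivMod using (_%_; _/_; m≡m%n+[m/n]*n; m%n%n≡m%n; %-distribˡ-+; [m+n]%n≡m%n; [m+kn]%n≡m%n; m<n⇒m%n≡m; m%n<n)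
open import Data.Nat.Tactic.RingSolver using (solve-∀)
open import Algebra.Properties.CommutativeSemigroup +-commutativeSemigroup using (interchange)
open import Data.Bool using (T; T?; _∧_)
open import Data.Bool.Properties using (T-∧)
open import Data.List using (List; []; _∷_; _++_; [_]; reverse; length; take; drop; upTo; map; filter; filterᵇ; applyUpTo; applyDownFrom)
open import Data.List.Properties using (length-++; length-reverse; length-drop; unfold-reverse; reverse-++; reverse-applyUpTo; take++drop≡id; ++-identityʳ; map-applyUpTo; length-applyUpTo; filter-++; filter-all; filter-none)
open import Data.List.Membership.Propositional using (_∈_)
open import Data.List.Membership.Propositional.Properties using (∈-applyUpTo⁺)
open import Data.List.Relation.Unary.All using (All)
open import Data.List.Relation.Unary.All.Properties using (applyUpTo⁺₁)
open import Data.List.Relation.Unary.Unique.Propositional using (Unique)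
import Data.List.Relation.Unary.Unique.Propositional.Properties as Unique
open import Data.List.Relation.Binary.Pointwise using (Pointwise)
import Data.List.Relation.Binary.Pointwise as Pointwise
open import Data.Product using (_×_; _,_; proj₁; proj₂; ∃; ∃-syntax)
open import Data.Sum using (_⊎_; inj₁; inj₂)
open import Data.Empty using (⊥-elim)
open import Function using (_∘_; Equivalence)
open import Level using (Level)
open import Relation.Nullary using (¬_; yes; no)
open import Relation.Unary using (Pred; Decidable)
open import Relation.Binary.Definitions using (tri<; tri≈; tri>)
open import Relation.Binary.PropositionalEquality hiding ([_])
open ≡-Reasoning

private
  variable
    ℓ : Level
    A B : Set ℓ

-- The letter of a word at a 0-based position; past the end it is the junk value a.
at : Word → ℕ → Letter
at []       _       = a
at (x ∷ xs) zero    = x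
at (x ∷ xs) (suc i) = at xs i

at-++ˡ : ∀ xs ys {i} → i < length xs → at (xs ++ ys) i ≡ at xs i
at-++ˡ (x ∷ xs) ys {zero}  _         = refl
at-++ˡ (x ∷ xs) ys {suc i} (s≤s i<) = at-++ˡ xs ys i<

at-++ʳ : ∀ xs ys i → at (xs ++ ys) (length xs + i) ≡ at ys i
at-++ʳ []       ys i = refl
at-++ʳ (x ∷ xs) ys i = at-++ʳ xs ys i

at-drop : ∀ s xs i → at (drop s xs) i ≡ at xs (s + i)
at-drop zero    xs       i = refl
at-drop (suc s) []       i = refl
at-drop (suc s) (x ∷ xs) i = at-drop s xs i

at-take : ∀ k xs {i} → i < k → at (take k xs) i ≡ at xs i
at-take (suc k) []       _         = refl
at-take (suc k) (x ∷ xs) {zero}  _ = refl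
at-take (suc k) (x ∷ xs) {suc i} (s≤s i<k) = at-take k xs i<k

at-reverse : ∀ xs {i j} → suc (i + j) ≡ length xs → at (reverse xs) i ≡ at xs j
at-reverse (x ∷ xs) {i} {j} eq rewrite unfold-reverse x xs with j
... | zero = begin
  at (reverse xs ++ [ x ]) i                         ≡⟨ cong (at (reverse xs ++ [ x ])) i≡ ⟩
  at (reverse xs ++ [ x ]) (length (reverse xs) + 0) ≡⟨ at-++ʳ (reverse xs) [ x ] 0 ⟩
  x                                                  ∎
  where
  i≡ : i ≡ length (reverse xs) + 0
  i≡ = trans (sym (+-identityʳ i)) (trans (suc-injective eq) (sym (trans (+-identityʳ _) (length-reverse xs))))
... | suc j = begin
  at (reverse xs ++ [ x ]) i ≡⟨ at-++ˡ (reverse xs) [ x ] (subst (i <_) (sym (length-reverse xs)) i<) ⟩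
  at (reverse xs) i          ≡⟨ at-reverse xs eq′ ⟩
  at xs j                    ∎
  where
  eq′ : suc (i + j) ≡ length xs
  eq′ = suc-injective (trans (cong suc (sym (+-suc i j))) eq)
  i< : i < length xs
  i< = subst (i <_) eq′ (s≤s (m≤m+n i j))

Palindrome⇒at-≡ : ∀ {xs} → Palindrome xs → ∀ {i j} → suc (i + j) ≡ length xs → at xs i ≡ at xs j
Palindrome⇒at-≡ {xs} pal eq = trans (cong (λ ys → at ys _) (sym pal)) (at-reverse xs eq)

take-≡-from-at : ∀ k xs ys → k ≤ length xs → k ≤ length ys →
                 (∀ {i} → i < k → at xs i ≡ at ys i) → take k xs ≡ take k ys
take-≡-from-at zero    xs       ys       _         _         _  = refl
take-≡-from-at (suc k) (x ∷ xs) (y ∷ ys) (s≤s k≤) (s≤s k≤′) eq =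
  cong₂ _∷_ (eq z<s) (take-≡-from-at k xs ys k≤ k≤′ (eq ∘ s<s))

factorAt-++ : ∀ (xs ys : Word) s r j → length xs ≡ s + r →
              factorAt (xs ++ ys) s (r + j) ≡ drop s xs ++ take j ys
factorAt-++ []       ys zero    zero    j refl = refl
factorAt-++ (x ∷ xs) ys zero    (suc r) j eq   = cong (x ∷_) (factorAt-++ xs ys zero r j (suc-injective eq))
factorAt-++ (x ∷ xs) ys (suc s) r       j eq   = factorAt-++ xs ys s r j (suc-injective eq)

applyUpTo-+ : ∀ (f : ℕ → A) m n → applyUpTo f (m + n) ≡ applyUpTo f m ++ applyUpTo (f ∘ (m +_)) n
applyUpTo-+ f zero    n = refl
applyUpTo-+ f (suc m) n = cong (f 0 ∷_) (applyUpTo-+ (f ∘ suc) m n)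

applyDownFrom≡applyUpTo : ∀ (f : ℕ → A) n → applyDownFrom f n ≡ applyUpTo (λ i → f (n ∸ suc i)) n
applyDownFrom≡applyUpTo f zero    = refl
applyDownFrom≡applyUpTo f (suc n) = cong (f n ∷_) (applyDownFrom≡applyUpTo f n)

applyUpTo-cong : ∀ {f g : ℕ → A} n → (∀ {i} → i < n → f i ≡ g i) → applyUpTo f n ≡ applyUpTo g n
applyUpTo-cong zero    eq = refl
applyUpTo-cong (suc n) eq = cong₂ _∷_ (eq z<s) (applyUpTo-cong n (eq ∘ s<s))

applyUpTo-Pointwise : ∀ {R : A → B → Set ℓ} {f g} n → (∀ {i} → i < n → R (f i) (g i)) →
                      Pointwise R (applyUpTo f n) (applyUpTo g n)
applyUpTo-Pointwise zero    r = Pointwise.[]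
applyUpTo-Pointwise (suc n) r = r z<s Pointwise.∷ applyUpTo-Pointwise n (r ∘ s<s)

module _ {P : Pred ℕ ℓ} (P? : Decidable P) where

  filter-upTo-interval : ∀ {lo len N} → lo + len ≤ N →
                         (∀ {s} → s < N → P s → lo ≤ s × s < lo + len) →
                         (∀ {s} → lo ≤ s → s < lo + len → P s) →
                         filter P? (upTo N) ≡ applyUpTo (lo +_) len
  filter-upTo-interval {lo} {len} bound sound complete with r , refl ← m≤n⇒∃[o]m+o≡n bound = begin
    filter P? (upTo (lo + len + r))
      ≡⟨ cong (filter P? ∘ upTo) (+-assoc lo len r) ⟩
    filter P? (upTo (lo + (len + r)))
      ≡⟨ cong (filter P?) (applyUpTo-+ (λ s → s) lo (len + r)) ⟩
    filter P? (upTo lo ++ applyUpTo (lo +_) (len + r))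
      ≡⟨ cong (λ xs → filter P? (upTo lo ++ xs)) (applyUpTo-+ (lo +_) len r) ⟩
    filter P? (upTo lo ++ (middle ++ above))
      ≡⟨ filter-++ P? (upTo lo) (middle ++ above) ⟩
    filter P? (upTo lo) ++ filter P? (middle ++ above)
      ≡⟨ cong (filter P? (upTo lo) ++_) (filter-++ P? middle above) ⟩
    filter P? (upTo lo) ++ (filter P? middle ++ filter P? above)
      ≡⟨ cong₂ (λ xs ys → xs ++ (ys ++ filter P? above))
               (filter-none P? rejectBelow) (filter-all P? acceptMiddle) ⟩
    middle ++ filter P? above
      ≡⟨ trans (cong (middle ++_) (filter-none P? rejectAbove)) (++-identityʳ middle) ⟩
    middle ∎
    where
    middle above : List ℕ
    middle = applyUpTo (lo +_) len
    above  = applyUpTo ((lo +_) ∘ (len +_)) r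
    N = lo + len + r
    rejectBelow : All (¬_ ∘ P) (upTo lo)
    rejectBelow = applyUpTo⁺₁ (λ s → s) lo λ {s} s<lo Ps →
      <-irrefl refl (<-≤-trans s<lo (proj₁ (sound (<-≤-trans s<lo (≤-trans (m≤m+n lo len) (m≤m+n _ r))) Ps)))
    acceptMiddle : All P middle
    acceptMiddle = applyUpTo⁺₁ (lo +_) len λ i<len → complete (m≤m+n lo _) (+-monoʳ-< lo i<len)
    rejectAbove : All (¬_ ∘ P) above
    rejectAbove = applyUpTo⁺₁ _ r λ {i} i<r Ps → <-irrefl refl (≤-<-trans (+-monoʳ-≤ lo (m≤m+n len i))
      (proj₂ (sound (subst (_< N) (+-assoc lo len i) (+-monoʳ-< (lo + len) i<r)) Ps)))

drop-++-length : ∀ (xs ys : List A) → drop (length xs) (xs ++ ys) ≡ ys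
drop-++-length []       ys = refl
drop-++-length (x ∷ xs) ys = drop-++-length xs ys

take-++-length : ∀ (xs ys : List A) → take (length xs) (xs ++ ys) ≡ xs
take-++-length []       ys = refl
take-++-length (x ∷ xs) ys = cong (x ∷_) (take-++-length xs ys)

drop-reverse : ∀ (xs : List A) s r → length xs ≡ s + r → drop r (reverse xs) ≡ reverse (take s xs)
drop-reverse xs s r eq = begin
  drop r (reverse xs)                               ≡⟨ cong (drop r ∘ reverse) (take++drop≡id s xs) ⟨
  drop r (reverse (take s xs ++ drop s xs))         ≡⟨ cong (drop r) (reverse-++ (take s xs) (drop s xs)) ⟩
  drop r (reverse (drop s xs) ++ reverse (take s xs)) ≡⟨ cong (λ m → drop m (ys ++ zs)) r≡ ⟩
  drop (length ys) (ys ++ zs)                       ≡⟨ drop-++-length ys zs ⟩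
  reverse (take s xs)                               ∎
  where
  ys = reverse (drop s xs)
  zs = reverse (take s xs)
  r≡ : r ≡ length (reverse (drop s xs))
  r≡ = sym (trans (length-reverse (drop s xs)) (trans (length-drop s xs) (trans (cong (_∸ s) eq) (m+n∸m≡n s r))))

countA-++ : ∀ xs ys → countA (xs ++ ys) ≡ countA xs + countA ys
countA-++ []       ys = refl
countA-++ (a ∷ xs) ys = cong suc (countA-++ xs ys)
countA-++ (b ∷ xs) ys = countA-++ xs ys

countB-++ : ∀ xs ys → countB (xs ++ ys) ≡ countB xs + countB ys
countB-++ []       ys = refl
countB-++ (a ∷ xs) ys = countB-++ xs ys
countB-++ (b ∷ xs) ys = cong suc (countB-++ xs ys)

module Additive (κ : Word → ℕ) (κ-++ : ∀ xs ys → κ (xs ++ ys) ≡ κ xs + κ ys) where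

  κ-reverse : ∀ xs → κ (reverse xs) ≡ κ xs
  κ-reverse []       = refl
  κ-reverse (x ∷ xs) = begin
    κ (reverse (x ∷ xs))     ≡⟨ cong κ (unfold-reverse x xs) ⟩
    κ (reverse xs ++ [ x ])  ≡⟨ κ-++ (reverse xs) [ x ] ⟩
    κ (reverse xs) + κ [ x ] ≡⟨ cong (_+ κ [ x ]) (κ-reverse xs) ⟩
    κ xs + κ [ x ]           ≡⟨ +-comm (κ xs) (κ [ x ]) ⟩
    κ [ x ] + κ xs           ≡⟨ κ-++ [ x ] xs ⟨
    κ (x ∷ xs)               ∎

  κ-drop+κ-take : ∀ s xs → κ (drop s xs) + κ (take s xs) ≡ κ xs
  κ-drop+κ-take s xs = begin
    κ (drop s xs) + κ (take s xs) ≡⟨ +-comm (κ (drop s xs)) (κ (take s xs)) ⟩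
    κ (take s xs) + κ (drop s xs) ≡⟨ κ-++ (take s xs) (drop s xs) ⟨
    κ (take s xs ++ drop s xs)    ≡⟨ cong κ (take++drop≡id s xs) ⟩
    κ xs                          ∎

  κ-drop-palindrome : ∀ {xs} → Palindrome xs → ∀ s r → length xs ≡ s + r → κ (drop r xs) ≡ κ (take s xs)
  κ-drop-palindrome {xs} pal s r eq = begin
    κ (drop r xs)             ≡⟨ cong (κ ∘ drop r) pal ⟨
    κ (drop r (reverse xs))   ≡⟨ cong κ (drop-reverse xs s r eq) ⟩
    κ (reverse (take s xs))   ≡⟨ κ-reverse (take s xs) ⟩
    κ (take s xs)             ∎

  -- The second window is made of the reversals of the two pieces of u ++ v that the first leaves out.
  κ-complementary-windows : ∀ {u v} → Palindrome u → Palindrome v → ∀ s r j e →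
    length u ≡ s + r → length v ≡ j + e →
    κ (factorAt (u ++ v) s (r + j)) + κ (factorAt (u ++ v) r (s + e)) ≡ κ (u ++ v)
  κ-complementary-windows {u} {v} pal-u pal-v s r j e |u| |v| = begin
    κ (factorAt (u ++ v) s (r + j)) + κ (factorAt (u ++ v) r (s + e))
      ≡⟨ cong₂ (λ x y → κ x + κ y) (factorAt-++ u v s r j |u|)
                                   (factorAt-++ u v r s e (trans |u| (+-comm s r))) ⟩
    κ (drop s u ++ take j v) + κ (drop r u ++ take e v)
      ≡⟨ cong₂ _+_ (κ-++ (drop s u) (take j v)) (κ-++ (drop r u) (take e v)) ⟩
    (κ (drop s u) + κ (take j v)) + (κ (drop r u) + κ (take e v))
      ≡⟨ interchange (κ (drop s u)) (κ (take j v)) (κ (drop r u)) (κ (take e v)) ⟩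
    (κ (drop s u) + κ (drop r u)) + (κ (take j v) + κ (take e v))
      ≡⟨ cong₂ (λ x y → (κ (drop s u) + x) + (y + κ (take e v)))
               (κ-drop-palindrome pal-u s r |u|) (sym (κ-drop-palindrome pal-v j e |v|)) ⟩
    (κ (drop s u) + κ (take s u)) + (κ (drop e v) + κ (take e v))
      ≡⟨ cong₂ _+_ (κ-drop+κ-take s u) (κ-drop+κ-take e v) ⟩
    κ u + κ v
      ≡⟨ κ-++ u v ⟨
    κ (u ++ v) ∎

MeetsCut : (n c k s : ℕ) → Set
MeetsCut n c k s = s ≤ c × c ≤ s + k × s + k ≤ n

-- For k + d = n, the windows of length k meeting the cut c form the interval [lo, lo + count),
-- and s ↦ c ∸ s maps them in reverse order onto those of length d, which start at lo′.
module CutWindows {n c k d : ℕ} (c≤n : c ≤ n) (k+d≡n : k + d ≡ n) where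

  lo lo′ count : ℕ
  lo    = c ∸ k
  lo′   = c ∸ d
  count = suc (c ∸ (lo + lo′))

  d+k≡n : d + k ≡ n
  d+k≡n = trans (+-comm d k) k+d≡n

  fits⇒≤d : ∀ {s} → s + k ≤ n → s ≤ d
  fits⇒≤d s+k≤n = +-cancelʳ-≤ k _ _ (subst (_ ≤_) (sym d+k≡n) s+k≤n)

  lo+lo′≤c : lo + lo′ ≤ c
  lo+lo′≤c with k ≤? c
  ... | yes k≤c = ≤-trans (+-monoʳ-≤ lo (m≤n+o⇒m∸n≤o c d (subst (c ≤_) (sym d+k≡n) c≤n)))
                          (≤-reflexive (m∸n+n≡m k≤c))
  ... | no k≰c = subst (λ x → x + lo′ ≤ c) (sym (m≤n⇒m∸n≡0 (<⇒≤ (≰⇒> k≰c)))) (m∸n≤m c d)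

  lo+count≡ : lo + count ≡ suc (c ∸ lo′)
  lo+count≡ = begin
    lo + suc (c ∸ (lo + lo′))  ≡⟨ +-suc lo _ ⟩
    suc (lo + (c ∸ (lo + lo′))) ≡⟨ cong (λ x → suc (lo + (c ∸ x))) (+-comm lo lo′) ⟩
    suc (lo + (c ∸ (lo′ + lo))) ≡⟨ cong (λ x → suc (lo + x)) (∸-+-assoc c lo′ lo) ⟨
    suc (lo + (c ∸ lo′ ∸ lo))   ≡⟨ cong suc (m+[n∸m]≡n (m+n≤o⇒m≤o∸n lo lo+lo′≤c)) ⟩
    suc (c ∸ lo′)               ∎

  meets⇒interval : ∀ {s} → MeetsCut n c k s → lo ≤ s × s < lo + count
  meets⇒interval {s} (s≤c , c≤s+k , s+k≤n) =
    m≤n+o⇒m∸n≤o c k (subst (c ≤_) (+-comm s k) c≤s+k) ,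
    subst (s <_) (sym lo+count≡) (s≤s (m+n≤o⇒m≤o∸n s s+lo′≤c))
    where
    s+lo′≤c : s + lo′ ≤ c
    s+lo′≤c with d ≤? c
    ... | yes d≤c = ≤-trans (+-monoˡ-≤ lo′ (fits⇒≤d s+k≤n)) (≤-reflexive (m+[n∸m]≡n d≤c))
    ... | no d≰c  = subst (λ x → s + x ≤ c) (sym (m≤n⇒m∸n≡0 (<⇒≤ (≰⇒> d≰c))))
                          (subst (_≤ c) (sym (+-identityʳ s)) s≤c)

  interval⇒meets : ∀ {s} → lo ≤ s → s < lo + count → MeetsCut n c k s
  interval⇒meets {s} lo≤s s<lo+count = ≤-trans (m≤m+n s lo′) s+lo′≤c , c≤s+k , s+k≤n
    where
    s+lo′≤c : s + lo′ ≤ c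
    s+lo′≤c = m≤o∸n⇒m+n≤o s (m∸n≤m c d) (s≤s⁻¹ (subst (s <_) lo+count≡ s<lo+count))
    c≤s+k : c ≤ s + k
    c≤s+k = ≤-trans (m≤n+m∸n c k) (subst (k + lo ≤_) (+-comm k s) (+-monoʳ-≤ k lo≤s))
    s+k≤n : s + k ≤ n
    s+k≤n = subst (s + k ≤_) d+k≡n (+-monoˡ-≤ k (+-cancelʳ-≤ lo′ s d
              (≤-trans s+lo′≤c (m≤n+m∸n c d))))

  filter-meets≡interval :
    filterᵇ (λ s → (s ≤ᵇ c) ∧ (c ≤ᵇ s + k)) (upTo (suc d)) ≡ applyUpTo (lo +_) count
  filter-meets≡interval = filter-upTo-interval (T? ∘ _) bound sound complete
    where
    bound : lo + count ≤ suc d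
    bound = subst (_≤ suc d) (sym lo+count≡) (s≤s (fits⇒≤d (proj₂ (proj₂ last-meets))))
      where
      last-meets : MeetsCut n c k (c ∸ lo′)
      last-meets = interval⇒meets (m+n≤o⇒m≤o∸n lo lo+lo′≤c) (subst (c ∸ lo′ <_) (sym lo+count≡) ≤-refl)
    sound : ∀ {s} → s < suc d → T ((s ≤ᵇ c) ∧ (c ≤ᵇ s + k)) → lo ≤ s × s < lo + count
    sound {s} s<1+d t with Equivalence.to T-∧ t
    ... | s≤ᵇc , c≤ᵇs+k = meets⇒interval (≤ᵇ⇒≤ s c s≤ᵇc , ≤ᵇ⇒≤ c (s + k) c≤ᵇs+k ,
                                          subst (s + k ≤_) d+k≡n (+-monoˡ-≤ k (s≤s⁻¹ s<1+d)))
    complete : ∀ {s} → lo ≤ s → s < lo + count → T ((s ≤ᵇ c) ∧ (c ≤ᵇ s + k))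
    complete lo≤s s<lo+count with interval⇒meets lo≤s s<lo+count
    ... | s≤c , c≤s+k , _ = Equivalence.from T-∧ (≤⇒≤ᵇ s≤c , ≤⇒≤ᵇ c≤s+k)

  mirror : ∀ {i} → i < count → c ∸ (lo + i) ≡ lo′ + (count ∸ suc i)
  mirror {i} i<count with r , i+r≡ ← m≤n⇒∃[o]m+o≡n (s≤s⁻¹ i<count) = begin
    c ∸ (lo + i)                     ≡⟨ cong (_∸ (lo + i)) c≡ ⟩
    (lo + lo′) + (i + r) ∸ (lo + i)  ≡⟨ cong (_∸ (lo + i)) (interchange lo lo′ i r) ⟩
    (lo + i) + (lo′ + r) ∸ (lo + i)  ≡⟨ m+n∸m≡n (lo + i) (lo′ + r) ⟩
    lo′ + r                          ≡⟨ cong (lo′ +_) (m+n∸m≡n i r) ⟨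
    lo′ + (i + r ∸ i)                ≡⟨ cong (λ x → lo′ + (x ∸ i)) i+r≡ ⟩
    lo′ + (count ∸ suc i)            ∎
    where
    c≡ : c ≡ (lo + lo′) + (i + r)
    c≡ = trans (sym (m+[n∸m]≡n lo+lo′≤c)) (cong ((lo + lo′) +_) (sym i+r≡))

  meets-index : ∀ {i} → i < count → MeetsCut n c k (lo + i)
  meets-index i<count = interval⇒meets (m≤m+n lo _) (+-monoʳ-< lo i<count)

  index-of-meets : ∀ {s} → MeetsCut n c k s → ∃ λ i → i < count × lo + i ≡ s
  index-of-meets meets with lo≤s , s<lo+count ← meets⇒interval meets
                       with i , lo+i≡s ← m≤n⇒∃[o]m+o≡n lo≤s =
    i , +-cancelˡ-< lo i count (subst (_< lo + count) (sym lo+i≡s) s<lo+count) , lo+i≡s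

meetsCut-mirror : ∀ {n c k d s} → k + d ≡ n → MeetsCut n c k s → MeetsCut n c d (c ∸ s)
meetsCut-mirror {n} {c} {k} {d} {s} k+d≡n (s≤c , c≤s+k , s+k≤n) =
  m∸n≤m c s ,
  ≤-trans (≤-reflexive (sym (m∸n+n≡m s≤c))) (+-monoʳ-≤ (c ∸ s) s≤d) ,
  subst ((c ∸ s) + d ≤_) k+d≡n (+-monoˡ-≤ d (m≤n+o⇒m∸n≤o c s c≤s+k))
  where
  s≤d : s ≤ d
  s≤d = +-cancelʳ-≤ k s d (subst (s + k ≤_) (trans (sym k+d≡n) (+-comm k d)) s+k≤n)

meetsCut-∸ : ∀ {n c k} → c ≤ n → k ≤ n → MeetsCut n c k (c ∸ k)
meetsCut-∸ {n} {c} {k} c≤n k≤n = interval⇒meets ≤-refl (m<m+n (c ∸ k) z<s)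
  where open CutWindows {n} {c} {k} {n ∸ k} c≤n (m+[n∸m]≡n k≤n)

meetsCut-or-beside : ∀ {n c k s} → s + k ≤ n → MeetsCut n c k s ⊎ (s + k < c ⊎ c < s)
meetsCut-or-beside {n} {c} {k} {s} fits with s + k <? c | c <? s
... | yes left  | _         = inj₂ (inj₁ left)
... | no _      | yes right = inj₂ (inj₂ right)
... | no ¬left  | no ¬right = inj₁ (≮⇒≥ ¬right , ≮⇒≥ ¬left , fits)

[m%n+o]%n≡[m+o]%n : ∀ m o n .{{_ : NonZero n}} → (m % n + o) % n ≡ (m + o) % n
[m%n+o]%n≡[m+o]%n m o n = begin
  (m % n + o) % n         ≡⟨ %-distribˡ-+ (m % n) o n ⟩
  (m % n % n + o % n) % n ≡⟨ cong (λ x → (x + o % n) % n) (m%n%n≡m%n m n) ⟩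
  (m % n + o % n) % n     ≡⟨ %-distribˡ-+ m o n ⟨
  (m + o) % n             ∎

-- The hypothesis says g ≡ -1 (mod n).
+-multiples-of-minus-one : ∀ {n} .{{_ : NonZero n}} {g} → suc (g % n) ≡ n →
                           ∀ s {e} → e < n → ∃ λ m → (s + m * g) % n ≡ e
+-multiples-of-minus-one {n} {g} g≡-1 s {e} e<n with r , refl ← m≤n⇒∃[o]m+o≡n e<n = s + suc r , (begin
  (s + (s + suc r) * g) % n                        ≡⟨ cong (λ x → (s + (s + suc r) * x) % n) g≡ ⟩
  (s + (s + suc r) * ((e + r) + g / n * n)) % n    ≡⟨ cong (_% n) (regroup s e r (g / n)) ⟩
  (e + ((s + r) + (s + suc r) * (g / n)) * n) % n  ≡⟨ [m+kn]%n≡m%n e ((s + r) + (s + suc r) * (g / n)) n ⟩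
  e % n                                            ≡⟨ m<n⇒m%n≡m e<n ⟩
  e                                                ∎)
  where
  g≡ : g ≡ (e + r) + g / n * n
  g≡ = trans (m≡m%n+[m/n]*n g n) (cong (_+ g / n * n) (suc-injective g≡-1))
  regroup : ∀ s e r K → s + (s + (1 + r)) * ((e + r) + K * (1 + e + r))
                      ≡ e + ((s + r) + (s + (1 + r)) * K) * (1 + e + r)
  regroup = solve-∀

-- W is read as a word w = u v with |u| = p and |v| = q: u and v are palindromes, so is w with its
-- first and last letters removed, and those two letters differ.
module CutSymmetric {A : Set} (W : ℕ → A) (p q : ℕ)
  (pal-u     : ∀ {i j} → suc (i + j) ≡ p → W i ≡ W j)
  (pal-v     : ∀ {i j} → suc (i + j) ≡ q → W (p + i) ≡ W (p + j))
  (pal-inner : ∀ {i j} → suc (i + j) ≡ p + q → 1 ≤ i → 1 ≤ j → W i ≡ W j)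
  (ends      : ∀ {j} → suc j ≡ p + q → 1 ≤ j → W 0 ≢ W j)
  where

  n : ℕ
  n = p + q

  Agree : ℕ → ℕ → ℕ → Set
  Agree k s s′ = ∀ {i} → i < k → W (s + i) ≡ W (s′ + i)

  agree-sym : ∀ {k s s′} → Agree k s s′ → Agree k s′ s
  agree-sym agree i<k = sym (agree i<k)

  agree-trans : ∀ {k s s′ s″} → Agree k s s′ → Agree k s′ s″ → Agree k s s″
  agree-trans agree agree′ i<k = trans (agree i<k) (agree′ i<k)

  agree-head : ∀ {k s s′} → Agree (suc k) s s′ → W s ≡ W s′
  agree-head {s = s} {s′} agree = subst₂ (λ x y → W x ≡ W y) (+-identityʳ s) (+-identityʳ s′) (agree z<s)

  -- A square x x centred on the cut would make the first letter of w equal to its last one.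
  no-square-at-cut : ∀ r d → r + suc d ≡ p → p + suc d ≤ n → ¬ Agree (suc d) r p
  no-square-at-cut r d r+1+d≡p p+1+d≤n agree
    with e , 1+d+e≡q ← m≤n⇒∃[o]m+o≡n (+-cancelˡ-≤ p (suc d) q p+1+d≤n) =
    ends {p + (d + e)} (trans (sym (+-suc p (d + e))) (cong (p +_) 1+d+e≡q)) 1≤last (first≡last d refl)
    where
    1≤p : 1 ≤ p
    1≤p = subst (1 ≤_) r+1+d≡p (≤-trans (s≤s z≤n) (≤-reflexive (sym (+-suc r d))))
    1≤last : 1 ≤ p + (d + e)
    1≤last = ≤-trans 1≤p (m≤m+n p (d + e))
    W0≡Wp+e : W 0 ≡ W (p + e)
    W0≡Wp+e = begin
      W 0       ≡⟨ pal-u (trans (sym (+-suc r d)) r+1+d≡p) ⟩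
      W (r + d) ≡⟨ agree ≤-refl ⟩
      W (p + d) ≡⟨ pal-v 1+d+e≡q ⟩
      W (p + e) ∎
    first≡last : ∀ d′ → d′ ≡ d → W 0 ≡ W (p + (d + e))
    first≡last zero      refl = W0≡Wp+e
    first≡last (suc d′) refl = begin
      W 0               ≡⟨ W0≡Wp+e ⟩
      W (p + e)         ≡⟨ pal-inner n≡ (≤-trans 1≤p (m≤m+n p e)) (s≤s z≤n) ⟩
      W (suc d′)        ≡⟨ pal-u (trans (cong suc (+-comm (suc d′) r)) (trans (sym (+-suc r (suc d′))) r+1+d≡p)) ⟩
      W r               ≡⟨ agree-head agree ⟩
      W p               ≡⟨ cong W (+-identityʳ p) ⟨
      W (p + 0)         ≡⟨ pal-v 1+d+e≡q ⟩
      W (p + (d + e))   ∎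
      where
      n≡ : suc (p + e + suc d′) ≡ p + q
      n≡ = trans (regroup p e d′) (cong (p +_) 1+d+e≡q)
        where
        regroup : ∀ p e d → 1 + (p + e + (1 + d)) ≡ p + (1 + (1 + d) + e)
        regroup = solve-∀

  meets-agree-< : ∀ {k s s′} → s < s′ → MeetsCut n p k s → MeetsCut n p k s′ → ¬ Agree k s s′
  meets-agree-< {k} {s} s<s′ (_ , p≤s+k , _) (s′≤p , _ , s′+k≤n) agree
    with δ , refl ← m≤n⇒∃[o]m+o≡n s<s′
    with o , s′+o≡p ← m≤n⇒∃[o]m+o≡n s′≤p =
    no-square-at-cut (s + o) δ (trans (regroup₁ s o δ) s′+o≡p) p+1+δ≤n agree′
    where
    s′ = suc s + δ
    regroup₁ : ∀ s o δ → s + o + (1 + δ) ≡ 1 + s + δ + o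
    regroup₁ = solve-∀
    regroup₂ : ∀ s o δ → s + (o + (1 + δ)) ≡ 1 + s + δ + o
    regroup₂ = solve-∀
    gap≤k : o + suc δ ≤ k
    gap≤k = +-cancelˡ-≤ s _ _ (subst (_≤ s + k) (sym (trans (regroup₂ s o δ) s′+o≡p)) p≤s+k)
    p+1+δ≤n : p + suc δ ≤ n
    p+1+δ≤n = subst (λ x → x + suc δ ≤ n) s′+o≡p
                (subst (_≤ n) (sym (+-assoc s′ o (suc δ))) (≤-trans (+-monoʳ-≤ s′ gap≤k) s′+k≤n))
    agree′ : Agree (suc δ) (s + o) p
    agree′ {i} i<1+δ = begin
      W (s + o + i)       ≡⟨ cong W (+-assoc s o i) ⟩
      W (s + (o + i))     ≡⟨ agree (<-≤-trans (+-monoʳ-< o i<1+δ) gap≤k) ⟩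
      W (s′ + (o + i))    ≡⟨ cong W (sym (+-assoc s′ o i)) ⟩
      W (s′ + o + i)      ≡⟨ cong (λ x → W (x + i)) s′+o≡p ⟩
      W (p + i)           ∎

  meets-agree⇒≡ : ∀ {k s s′} → MeetsCut n p k s → MeetsCut n p k s′ → Agree k s s′ → s ≡ s′
  meets-agree⇒≡ {s = s} {s′} meets meets′ agree with <-cmp s s′
  ... | tri< s<s′ _ _ = ⊥-elim (meets-agree-< s<s′ meets meets′ agree)
  ... | tri≈ _ s≡s′ _ = s≡s′
  ... | tri> _ _ s′<s = ⊥-elim (meets-agree-< s′<s meets′ meets (agree-sym agree))

  agree-shift-left : ∀ {k s} → 1 ≤ q → s + k < p → Agree k s (s + q)
  agree-shift-left {k} {s} 1≤q s+k<p {i} i<k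
    with r , refl ← m≤n⇒∃[o]m+o≡n (<-≤-trans (s<s (+-monoʳ-< s i<k)) s+k<p) = begin
    W (s + i)         ≡⟨ pal-u (regroup₁ (s + i) r) ⟩
    W (suc r)         ≡⟨ pal-inner (regroup₂ (s + i) r q) (s≤s z≤n) (≤-trans 1≤q (m≤n+m q (s + i))) ⟩
    W (s + i + q)     ≡⟨ cong W (regroup₃ s i q) ⟩
    W (s + q + i)     ∎
    where
    regroup₁ : ∀ x r → 1 + (x + (1 + r)) ≡ 1 + (1 + x) + r
    regroup₁ = solve-∀
    regroup₂ : ∀ x r q → 1 + ((1 + r) + (x + q)) ≡ (1 + (1 + x) + r) + q
    regroup₂ = solve-∀
    regroup₃ : ∀ s i q → s + i + q ≡ s + q + i
    regroup₃ = solve-∀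

  agree-shift-right : ∀ {k i} → 1 ≤ p → 1 ≤ i → p + i + k ≤ n → Agree k (p + i) i
  agree-shift-right {k} {i} 1≤p 1≤i fits {j} j<k
    with r , 1+i+j+r≡q ← m≤n⇒∃[o]m+o≡n (+-cancelˡ-< p (i + j) q
           (subst (_< n) (+-assoc p i j) (<-≤-trans (+-monoʳ-< (p + i) j<k) fits))) = begin
    W (p + i + j)   ≡⟨ cong W (+-assoc p i j) ⟩
    W (p + (i + j)) ≡⟨ pal-v (trans (cong suc (+-comm r (i + j))) 1+i+j+r≡q) ⟨
    W (p + r)       ≡⟨ pal-inner (trans (regroup p r (i + j)) (cong (p +_) 1+i+j+r≡q))
                                 (≤-trans 1≤p (m≤m+n p r)) (≤-trans 1≤i (m≤m+n i j)) ⟩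
    W (i + j)       ∎
    where
    regroup : ∀ p r x → 1 + ((p + r) + x) ≡ p + (1 + (x + r))
    regroup = solve-∀

  module Rotation (1≤p : 1 ≤ p) (1≤q : 1 ≤ q) where

    instance
      n-nonZero : NonZero n
      n-nonZero = >-nonZero (≤-trans 1≤p (m≤m+n p q))

    p<n : p < n
    p<n = m<m+n p 1≤q

    rotate : ℕ → ℕ
    rotate x = (x + q) % n

    orbit : ℕ → ℕ → ℕ
    orbit s t = (s + t * q) % n

    rotate-left : ∀ {x} → x < p → rotate x ≡ x + q
    rotate-left x<p = m<n⇒m%n≡m (+-monoˡ-< q x<p)

    rotate-right : ∀ {i} → i < q → rotate (p + i) ≡ i
    rotate-right {i} i<q = begin
      (p + i + q) % n ≡⟨ cong (_% n) (trans (cong (_+ q) (+-comm p i)) (+-assoc i p q)) ⟩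
      (i + n) % n     ≡⟨ [m+n]%n≡m%n i n ⟩
      i % n           ≡⟨ m<n⇒m%n≡m (≤-trans i<q (m≤n+m q p)) ⟩
      i               ∎

    orbit-zero : ∀ {s} → s < n → orbit s 0 ≡ s
    orbit-zero {s} s<n = trans (cong (_% n) (+-identityʳ s)) (m<n⇒m%n≡m s<n)

    orbit-rotate : ∀ s t → orbit (rotate s) t ≡ orbit s (suc t)
    orbit-rotate s t = trans ([m%n+o]%n≡[m+o]%n (s + q) (t * q) n) (cong (_% n) (+-assoc s q (t * q)))

    rotate-orbit : ∀ s t → rotate (orbit s t) ≡ orbit s (suc t)
    rotate-orbit s t = trans ([m%n+o]%n≡[m+o]%n (s + t * q) q n)
      (cong (_% n) (trans (+-assoc s (t * q) q) (cong (s +_) (+-comm (t * q) q))))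

    W0≢Wp : W 0 ≢ W p
    W0≢Wp W0≡Wp with q′ , 1+q′≡q ← m≤n⇒∃[o]m+o≡n 1≤q =
      ends (trans (sym (+-suc p q′)) (cong (p +_) 1+q′≡q)) (≤-trans 1≤p (m≤m+n p q′))
           (trans W0≡Wp (trans (cong W (sym (+-identityʳ p))) (pal-v 1+q′≡q)))

    rotate-window : ∀ {k s} → s < n → s + k ≤ n → s + k < p ⊎ p < s →
                    rotate s + k ≤ n × Agree k s (rotate s)
    rotate-window {k} {s} _ fits (inj₁ s+k<p) =
      subst (λ x → x + k ≤ n) (sym (rotate-left s<p))
            (subst (_≤ n) (regroup s k q) (+-monoˡ-≤ q (<⇒≤ s+k<p))) ,
      subst (Agree k s) (sym (rotate-left s<p)) (agree-shift-left 1≤q s+k<p)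
      where
      s<p : s < p
      s<p = ≤-<-trans (m≤m+n s k) s+k<p
      regroup : ∀ s k q → s + k + q ≡ s + q + k
      regroup = solve-∀
    rotate-window {k} s<n fits (inj₂ p<s) with i , refl ← m≤n⇒∃[o]m+o≡n (<⇒≤ p<s) =
      subst (λ x → x + k ≤ n) (sym (rotate-right i<q))
            (≤-trans (m≤n+m (i + k) p) (subst (_≤ n) (+-assoc p i k) fits)) ,
      subst (Agree k (p + i)) (sym (rotate-right i<q)) (agree-shift-right 1≤p 1≤i fits)
      where
      1≤i : 1 ≤ i
      1≤i = +-cancelˡ-≤ p 1 i (subst (_≤ p + i) (+-comm 1 p) p<s)
      i<q : i < q
      i<q = +-cancelˡ-< p i q s<n

    W-rotate : ∀ {y} → y < n → suc y ≢ p → y ≢ p → W (rotate y) ≡ W y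
    W-rotate {y} y<n 1+y≢p y≢p with <-cmp y p
    ... | tri< y<p _ _ = sym (agree-head (proj₂ (rotate-window y<n y+1≤n (inj₁ y+1<p))))
      where
      y+1<p : y + 1 < p
      y+1<p = subst (_< p) (+-comm 1 y) (≤∧≢⇒< y<p 1+y≢p)
      y+1≤n : y + 1 ≤ n
      y+1≤n = subst (_≤ n) (+-comm 1 y) y<n
    ... | tri≈ _ y≡p _ = ⊥-elim (y≢p y≡p)
    ... | tri> _ _ p<y = sym (agree-head (proj₂ (rotate-window y<n (subst (_≤ n) (+-comm 1 y) y<n) (inj₂ p<y))))

    -- Along the orbit of 0 the letter cannot change before the orbit enters p - 1, since entering p
    -- instead would give W 0 = W p.
    orbit-reaches-cut : ∀ t → (∃ λ c → suc (orbit 0 c) ≡ p) ⊎ W (orbit 0 t) ≡ W 0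
    orbit-reaches-cut zero = inj₂ (cong W (orbit-zero (≤-<-trans z≤n p<n)))
    orbit-reaches-cut (suc t) with orbit-reaches-cut t
    ... | inj₁ hit = inj₁ hit
    ... | inj₂ same with suc (orbit 0 t) ≟ p
    ...   | yes hit = inj₁ (t , hit)
    ...   | no miss = inj₂ (begin
      W (orbit 0 (suc t))    ≡⟨ cong W (rotate-orbit 0 t) ⟨
      W (rotate (orbit 0 t)) ≡⟨ W-rotate (m%n<n _ n) miss (λ y≡p → W0≢Wp (trans (sym same) (cong W y≡p))) ⟩
      W (orbit 0 t)          ≡⟨ same ⟩
      W 0                    ∎)

    orbit-0-hits-p : ∀ {q′} → suc q′ ≡ q → orbit 0 (p + q′) ≡ p
    orbit-0-hits-p {q′} 1+q′≡q = begin
      ((p + q′) * q) % n              ≡⟨ cong (λ x → ((p + q′) * x) % n) (sym 1+q′≡q) ⟩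
      ((p + q′) * suc q′) % n         ≡⟨ cong (_% n) (regroup p q′) ⟩
      (p + q′ * (p + suc q′)) % n     ≡⟨ cong (λ x → (p + q′ * (p + x)) % n) 1+q′≡q ⟩
      (p + q′ * n) % n                ≡⟨ [m+kn]%n≡m%n p q′ n ⟩
      p % n                           ≡⟨ m<n⇒m%n≡m p<n ⟩
      p                               ∎
      where
      regroup : ∀ p q′ → (p + q′) * (1 + q′) ≡ p + q′ * (p + (1 + q′))
      regroup = solve-∀

    minus-one-multiple : ∃ λ c → suc ((c * q) % n) ≡ n
    minus-one-multiple with q′ , 1+q′≡q ← m≤n⇒∃[o]m+o≡n 1≤q with orbit-reaches-cut (p + q′)
    ... | inj₂ same    = ⊥-elim (W0≢Wp (trans (sym same) (cong W (orbit-0-hits-p 1+q′≡q))))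
    ... | inj₁ (c , hit) = suc c , (begin
      suc ((q + c * q) % n)       ≡⟨ cong (λ x → suc (x % n)) (+-comm q (c * q)) ⟩
      suc ((c * q + q) % n)       ≡⟨ cong suc ([m%n+o]%n≡[m+o]%n (c * q) q n) ⟨
      suc ((c * q % n + q) % n)   ≡⟨ cong suc (m<n⇒m%n≡m (+-monoˡ-< q (≤-reflexive hit))) ⟩
      suc (c * q % n) + q         ≡⟨ cong (_+ q) hit ⟩
      n                           ∎)

    orbit-reaches : ∀ s {e} → e < n → ∃ λ t → orbit s t ≡ e
    orbit-reaches s e<n with c , c≡-1 ← minus-one-multiple with m , hit ← +-multiples-of-minus-one c≡-1 s e<n =
      m * c , trans (cong (λ x → (s + x) % n) (*-assoc m c q)) hit

    orbit-meets⇒representative : ∀ {k} t s → s < n → s + k ≤ n → MeetsCut n p k (orbit s t) →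
                                 ∃ λ s′ → MeetsCut n p k s′ × Agree k s s′
    orbit-meets⇒representative zero s s<n fits meets =
      s , subst (MeetsCut n p _) (orbit-zero s<n) meets , λ _ → refl
    orbit-meets⇒representative (suc t) s s<n fits meets with meetsCut-or-beside fits
    ... | inj₁ meets-s = s , meets-s , λ _ → refl
    ... | inj₂ beside with rotate-window s<n fits beside
    ...   | fits′ , agree
      with orbit-meets⇒representative t (rotate s) (m%n<n _ n) fits′
             (subst (MeetsCut n p _) (sym (orbit-rotate s t)) meets)
    ...     | s′ , meets′ , agree′ = s′ , meets′ , agree-trans agree agree′

    representative : ∀ {k s} → s < n → s + k ≤ n → ∃ λ s′ → MeetsCut n p k s′ × Agree k s s′
    representative {k} {s} s<n fits with t , hit ← orbit-reaches s (≤-<-trans (m∸n≤m p k) p<n) =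
      orbit-meets⇒representative t s s<n fits
        (subst (MeetsCut n p k) (sym hit) (meetsCut-∸ (<⇒≤ p<n) (≤-trans (m≤n+m k s) fits)))

  cut-positive : 2 ≤ n → 1 ≤ p × 1 ≤ q
  cut-positive 2≤n with o , 2+o≡n ← m≤n⇒∃[o]m+o≡n 2≤n = positive-p , positive-q
    where
    positive-p : 1 ≤ p
    positive-p with p ≟ 0
    ... | yes p≡0 = ⊥-elim (ends 2+o≡n (s≤s z≤n)
                      (subst (λ x → W (x + 0) ≡ W (x + suc o)) p≡0 (pal-v (trans 2+o≡n (cong (_+ q) p≡0)))))
    ... | no p≢0  = n≢0⇒n>0 p≢0
    positive-q : 1 ≤ q
    positive-q with q ≟ 0
    ... | yes q≡0 = ⊥-elim (ends 2+o≡n (s≤s z≤n)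
                      (pal-u (trans 2+o≡n (trans (cong (p +_) q≡0) (+-identityʳ p)))))
    ... | no q≢0  = n≢0⇒n>0 q≢0

  meets-representative : ∀ k s → s + k ≤ n → ∃ λ s′ → MeetsCut n p k s′ × Agree k s s′
  meets-representative zero s _ =
    p , (≤-refl , m≤m+n p 0 , subst (_≤ n) (sym (+-identityʳ p)) (m≤m+n p q)) , λ ()
  meets-representative (suc k) s fits with 2 ≤? n
  ... | yes 2≤n = let 1≤p , 1≤q = cut-positive 2≤n in
    Rotation.representative 1≤p 1≤q (<-≤-trans (m<m+n s z<s) fits) fits
  ... | no 2≰n = s , (s≤p , p≤s+1+k , fits) , λ _ → refl
    where
    n≤1 : n ≤ 1
    n≤1 = s≤s⁻¹ (≰⇒> 2≰n)
    s≤p : s ≤ p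
    s≤p = ≤-trans (≤-trans (m≤m+n s k) (s≤s⁻¹ (subst (_≤ 1) (+-suc s k) (≤-trans fits n≤1)))) z≤n
    p≤s+1+k : p ≤ s + suc k
    p≤s+1+k = ≤-trans (m≤m+n p q) (≤-trans n≤1 (subst (1 ≤_) (sym (+-suc s k)) (s≤s z≤n)))

parikh-complementary-windows : ∀ {u v} → Palindrome u → Palindrome v → ∀ s r j e →
  length u ≡ s + r → length v ≡ j + e →
  parikh (factorAt (u ++ v) s (r + j)) ⊕ parikh (factorAt (u ++ v) r (s + e)) ≡ parikh (u ++ v)
parikh-complementary-windows pal-u pal-v s r j e |u| |v| = cong₂ _,_
  (Additive.κ-complementary-windows countA countA-++ pal-u pal-v s r j e |u| |v|)
  (Additive.κ-complementary-windows countB countB-++ pal-u pal-v s r j e |u| |v|)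

christoffel-shape : ∀ {w} → IsChristoffel w →
  length w ≡ 1 ⊎ ∃[ x ] ∃[ y ] ∃[ m ] x ≢ y × Palindrome m × w ≡ x ∷ (m ++ [ y ])
christoffel-shape (inj₁ refl)                            = inj₁ refl
christoffel-shape (inj₂ (inj₁ refl))                     = inj₁ refl
christoffel-shape (inj₂ (inj₂ (m , pal , inj₁ w≡ , _))) = inj₂ (a , b , m , (λ ()) , pal , w≡)
christoffel-shape (inj₂ (inj₂ (m , pal , inj₂ w≡ , _))) = inj₂ (b , a , m , (λ ()) , pal , w≡)

length-x∷m++[y] : ∀ x m (y : Letter) {j} → suc j ≡ length (x ∷ (m ++ [ y ])) → j ≡ suc (length m)
length-x∷m++[y] x m y eq = trans (suc-injective eq) (trans (length-++ m) (+-comm (length m) 1))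

christoffel-inner : ∀ {w} → IsChristoffel w →
                    ∀ {i j} → suc (i + j) ≡ length w → 1 ≤ i → 1 ≤ j → at w i ≡ at w j
christoffel-inner chr {suc i} {suc j} eq _ _ with christoffel-shape chr
... | inj₁ |w|≡1 = ⊥-elim (1+n≢0 (suc-injective (trans eq |w|≡1)))
... | inj₂ (x , y , m , _ , pal , refl) = begin
  at (m ++ [ y ]) i ≡⟨ at-++ˡ m [ y ] (subst (i <_) |m| (s≤s (m≤m+n i j))) ⟩
  at m i            ≡⟨ Palindrome⇒at-≡ pal |m| ⟩
  at m j            ≡⟨ at-++ˡ m [ y ] (subst (j <_) |m| (s≤s (m≤n+m j i))) ⟨
  at (m ++ [ y ]) j ∎
  where
  |m| : suc (i + j) ≡ length m
  |m| = suc-injective (trans (sym (+-suc (suc i) j)) (length-x∷m++[y] x m y eq))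

christoffel-ends : ∀ {w} → IsChristoffel w → ∀ {j} → suc j ≡ length w → 1 ≤ j → at w 0 ≢ at w j
christoffel-ends chr {suc j} eq _ with christoffel-shape chr
... | inj₁ |w|≡1 = ⊥-elim (1+n≢0 (suc-injective (trans eq |w|≡1)))
... | inj₂ (x , y , m , x≢y , _ , refl) = λ x≡ → x≢y (begin
  x                                ≡⟨ x≡ ⟩
  at (m ++ [ y ]) j                ≡⟨ cong (at (m ++ [ y ])) j≡ ⟩
  at (m ++ [ y ]) (length m + 0)   ≡⟨ at-++ʳ m [ y ] 0 ⟩
  y                                ∎)
  where
  j≡ : j ≡ length m + 0
  j≡ = trans (suc-injective (length-x∷m++[y] x m y eq)) (sym (+-identityʳ _))

module CutFactorisation {u v : Word} (christoffel : IsChristoffel (u ++ v))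
                        (pal-u : Palindrome u) (pal-v : Palindrome v) where

  w : Word
  w = u ++ v

  p q : ℕ
  p = length u
  q = length v

  |w|≡p+q : length w ≡ p + q
  |w|≡p+q = length-++ u

  at-u : ∀ {i j} → suc (i + j) ≡ p → at w i ≡ at w j
  at-u {i} {j} eq = begin
    at w i ≡⟨ at-++ˡ u v (subst (i <_) eq (s≤s (m≤m+n i j))) ⟩
    at u i ≡⟨ Palindrome⇒at-≡ pal-u eq ⟩
    at u j ≡⟨ at-++ˡ u v (subst (j <_) eq (s≤s (m≤n+m j i))) ⟨
    at w j ∎

  at-v : ∀ {i j} → suc (i + j) ≡ q → at w (p + i) ≡ at w (p + j)
  at-v {i} {j} eq = trans (at-++ʳ u v i) (trans (Palindrome⇒at-≡ pal-v eq) (sym (at-++ʳ u v j)))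

  open CutSymmetric (at w) p q at-u at-v
    (λ eq → christoffel-inner christoffel (trans eq (sym |w|≡p+q)))
    (λ eq → christoffel-ends christoffel (trans eq (sym |w|≡p+q)))

  factorAt-≡⇒agree : ∀ {k s s′} → factorAt w s k ≡ factorAt w s′ k → Agree k s s′
  factorAt-≡⇒agree {k} {s} {s′} eq {i} i<k = begin
    at w (s + i)           ≡⟨ at-drop s w i ⟨
    at (drop s w) i        ≡⟨ at-take k (drop s w) i<k ⟨
    at (factorAt w s k) i  ≡⟨ cong (λ x → at x i) eq ⟩
    at (factorAt w s′ k) i ≡⟨ at-take k (drop s′ w) i<k ⟩
    at (drop s′ w) i       ≡⟨ at-drop s′ w i ⟩
    at w (s′ + i)          ∎

  agree⇒factorAt-≡ : ∀ {k s s′} → s + k ≤ n → s′ + k ≤ n → Agree k s s′ →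
                     factorAt w s k ≡ factorAt w s′ k
  agree⇒factorAt-≡ {k} {s} {s′} fits fits′ agree =
    take-≡-from-at k (drop s w) (drop s′ w) (fits-drop fits) (fits-drop fits′)
      λ {i} i<k → trans (at-drop s w i) (trans (agree i<k) (sym (at-drop s′ w i)))
    where
    fits-drop : ∀ {t} → t + k ≤ n → k ≤ length (drop t w)
    fits-drop {t} t+k≤n = subst (k ≤_) (sym (trans (length-drop t w) (cong (_∸ t) |w|≡p+q)))
                                (m+n≤o⇒m≤o∸n k (subst (_≤ n) (+-comm t k) t+k≤n))

  Factor⇒window : ∀ {x} → Factor x w → ∃ λ s → s + length x ≤ n × factorAt w s (length x) ≡ x
  Factor⇒window {x} (y , z , w≡) = length y , fits , (begin
    factorAt w (length y) (length x)                 ≡⟨ cong (take (length x) ∘ drop (length y)) w≡ ⟩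
    take (length x) (drop (length y) (y ++ x ++ z))  ≡⟨ cong (take (length x)) (drop-++-length y (x ++ z)) ⟩
    take (length x) (x ++ z)                         ≡⟨ take-++-length x z ⟩
    x                                                ∎)
    where
    fits : length y + length x ≤ n
    fits = subst (length y + length x ≤_)
             (trans (sym (trans (length-++ y) (cong (length y +_) (length-++ x))))
                    (trans (cong length (sym w≡)) |w|≡p+q))
             (+-monoʳ-≤ (length y) (m≤m+n (length x) (length z)))

  factor-meeting-cut : ∀ {x} → Factor x w → ∃ λ s → MeetsCut n p (length x) s × factorAt w s (length x) ≡ x
  factor-meeting-cut factor with s , fits , x≡ ← Factor⇒window factor
                             with s′ , meets , agree ← meets-representative _ s fits =
    s′ , meets , trans (sym (agree⇒factorAt-≡ fits (proj₂ (proj₂ meets)) agree)) x≡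

  module CutLists {k : ℕ} (k≤n : k ≤ length w) where

    d : ℕ
    d = length w ∸ k

    k+d≡n : k + d ≡ n
    k+d≡n = trans (m+[n∸m]≡n k≤n) |w|≡p+q

    open CutWindows {n} {p} {k} {d} (m≤m+n p q) k+d≡n
    module Dual = CutWindows {n} {p} {d} {k} (m≤m+n p q) d+k≡n

    F G : ℕ → Word
    F s = factorAt w s k
    G t = factorAt w t d

    cutFactorsK≡ : cutFactorsK w p k ≡ applyUpTo (λ i → F (lo + i)) count
    cutFactorsK≡ = trans (cong (map F) filter-meets≡interval) (map-applyUpTo (lo +_) F count)

    cutFactorsCoK≡ : cutFactorsCoK w p k ≡ applyUpTo (λ i → G (p ∸ (lo + i))) count
    cutFactorsCoK≡ = begin
      map G (reverse (filterᵇ (λ t → (t ≤ᵇ p) ∧ (p ≤ᵇ t + d)) (upTo (suc k))))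
        ≡⟨ cong (map G ∘ reverse) Dual.filter-meets≡interval ⟩
      map G (reverse (applyUpTo (lo′ +_) Dual.count))
        ≡⟨ cong (λ x → map G (reverse (applyUpTo (lo′ +_) (suc (p ∸ x))))) (+-comm lo′ lo) ⟩
      map G (reverse (applyUpTo (lo′ +_) count))
        ≡⟨ cong (map G) (trans (reverse-applyUpTo (lo′ +_) count) (applyDownFrom≡applyUpTo (lo′ +_) count)) ⟩
      map G (applyUpTo (λ i → lo′ + (count ∸ suc i)) count)
        ≡⟨ map-applyUpTo (λ i → lo′ + (count ∸ suc i)) G count ⟩
      applyUpTo (λ i → G (lo′ + (count ∸ suc i))) count
        ≡⟨ applyUpTo-cong count (λ i<count → cong G (sym (mirror i<count))) ⟩
      applyUpTo (λ i → G (p ∸ (lo + i))) count ∎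

    length-≡ : length (cutFactorsK w p k) ≡ length (cutFactorsCoK w p k)
    length-≡ = begin
      length (cutFactorsK w p k)                       ≡⟨ cong length cutFactorsK≡ ⟩
      length (applyUpTo (λ i → F (lo + i)) count)      ≡⟨ length-applyUpTo (λ i → F (lo + i)) count ⟩
      count                                            ≡⟨ length-applyUpTo (λ i → G (p ∸ (lo + i))) count ⟨
      length (applyUpTo (λ i → G (p ∸ (lo + i))) count) ≡⟨ cong length cutFactorsCoK≡ ⟨
      length (cutFactorsCoK w p k)                     ∎

    unique-K : Unique (cutFactorsK w p k)
    unique-K = subst Unique (sym cutFactorsK≡) (Unique.applyUpTo⁺₁ _ count λ i<j j<count eq →
      <⇒≢ (+-monoʳ-< lo i<j)
          (meets-agree⇒≡ (meets-index (<-trans i<j j<count)) (meets-index j<count) (factorAt-≡⇒agree eq)))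

    unique-CoK : Unique (cutFactorsCoK w p k)
    unique-CoK = subst Unique (sym cutFactorsCoK≡) (Unique.applyUpTo⁺₁ _ count λ {i} {j} i<j j<count eq →
      <⇒≢ (∸-monoʳ-< (+-monoʳ-< lo i<j) (proj₁ (meets-index j<count)))
          (meets-agree⇒≡ (mirrored j<count) (mirrored (<-trans i<j j<count)) (factorAt-≡⇒agree (sym eq))))
      where
      mirrored : ∀ {i} → i < count → MeetsCut n p d (p ∸ (lo + i))
      mirrored i<count = meetsCut-mirror k+d≡n (meets-index i<count)

    complete-K : (x : Word) → Factor x w → length x ≡ k → x ∈ cutFactorsK w p k
    complete-K x factor |x|≡k
      with s , meets , x≡ ← factor-meeting-cut factor
      with i , i<count , lo+i≡s ← index-of-meets (subst (λ m → MeetsCut n p m s) |x|≡k meets) =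
      subst (x ∈_) (sym cutFactorsK≡)
        (subst (_∈ applyUpTo (λ i → F (lo + i)) count)
               (trans (cong₂ (factorAt w) lo+i≡s (sym |x|≡k)) x≡)
               (∈-applyUpTo⁺ (λ i → F (lo + i)) i<count))

    complete-CoK : (x : Word) → Factor x w → length x ≡ d → x ∈ cutFactorsCoK w p k
    complete-CoK x factor |x|≡d
      with t , meets , x≡ ← factor-meeting-cut factor
      with i , i<count , lo+i≡p∸t ←
             index-of-meets (meetsCut-mirror d+k≡n (subst (λ m → MeetsCut n p m t) |x|≡d meets)) =
      subst (x ∈_) (sym cutFactorsCoK≡)
        (subst (_∈ applyUpTo (λ i → G (p ∸ (lo + i))) count)
               (trans (cong₂ (factorAt w) (trans (cong (p ∸_) lo+i≡p∸t) (m∸[m∸n]≡n (proj₁ meets)))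
                                          (sym |x|≡d))
                      x≡)
               (∈-applyUpTo⁺ (λ i → G (p ∸ (lo + i))) i<count))

    parikh-complementary : ∀ {s} → MeetsCut n p k s → parikh (F s) ⊕ parikh (G (p ∸ s)) ≡ parikh w
    parikh-complementary {s} (s≤p , p≤s+k , s+k≤n)
      with r , s+r≡p ← m≤n⇒∃[o]m+o≡n s≤p
      with j , r+j≡k ← m≤n⇒∃[o]m+o≡n (+-cancelˡ-≤ s r k (subst (_≤ s + k) (sym s+r≡p) p≤s+k))
      with e , s+k+e≡n ← m≤n⇒∃[o]m+o≡n s+k≤n = begin
      parikh (factorAt w s k) ⊕ parikh (factorAt w (p ∸ s) d)
        ≡⟨ cong₂ _⊕_ (cong (parikh ∘ factorAt w s) (sym r+j≡k))
                     (cong₂ (λ t m → parikh (factorAt w t m)) p∸s≡r d≡s+e) ⟩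
      parikh (factorAt w s (r + j)) ⊕ parikh (factorAt w r (s + e))
        ≡⟨ parikh-complementary-windows pal-u pal-v s r j e (sym s+r≡p) |v|≡j+e ⟩
      parikh w ∎
      where
      regroup₁ : ∀ s r j e → s + (r + j) + e ≡ s + r + (j + e)
      regroup₁ = solve-∀
      regroup₂ : ∀ s k e → s + k + e ≡ k + (s + e)
      regroup₂ = solve-∀
      p∸s≡r : p ∸ s ≡ r
      p∸s≡r = trans (cong (_∸ s) (sym s+r≡p)) (m+n∸m≡n s r)
      n≡ : n ≡ p + (j + e)
      n≡ = trans (sym s+k+e≡n) (trans (cong (λ m → s + m + e) (sym r+j≡k))
                 (trans (regroup₁ s r j e) (cong (_+ (j + e)) s+r≡p)))
      |v|≡j+e : q ≡ j + e
      |v|≡j+e = +-cancelˡ-≡ p q (j + e) n≡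
      d≡s+e : d ≡ s + e
      d≡s+e = +-cancelˡ-≡ k d (s + e) (trans k+d≡n (trans (sym s+k+e≡n) (regroup₂ s k e)))

    parikh-K : Pointwise (λ f g → parikh f ⊕ parikh g ≡ parikh w) (cutFactorsK w p k) (cutFactorsCoK w p k)
    parikh-K = subst₂ (Pointwise (λ f g → parikh f ⊕ parikh g ≡ parikh w))
                      (sym cutFactorsK≡) (sym cutFactorsCoK≡)
      (applyUpTo-Pointwise {f = λ i → F (lo + i)} {g = λ i → G (p ∸ (lo + i))} count
        λ i<count → parikh-complementary (meets-index i<count))

theorem4 : (w u v : Word) → IsChristoffel w → PalFact w u v →
  (k : ℕ) → k ≤ length w →
  length (cutFactorsK w (length u) k) ≡ length (cutFactorsCoK w (length u) k)
  × Unique (cutFactorsK w (length u) k)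
  × Unique (cutFactorsCoK w (length u) k)
  × ((x : Word) → Factor x w → length x ≡ k → x ∈ cutFactorsK w (length u) k)
  × ((x : Word) → Factor x w → length x ≡ length w ∸ k → x ∈ cutFactorsCoK w (length u) k)
  × Pointwise (λ f g → parikh f ⊕ parikh g ≡ parikh w)
      (cutFactorsK w (length u) k) (cutFactorsCoK w (length u) k)
theorem4 w u v christoffel (pal-u , pal-v , refl) k k≤n =
  length-≡ , unique-K , unique-CoK , complete-K , complete-CoK , parikh-K
  where
  open CutFactorisation christoffel pal-u pal-v
  open CutLists k≤n
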